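{- Let $\delta\neq 0$ be a complex constant, $\{a_i\},\{b_i\},\{c_i\},\{d_i\}$ ($i\in\mathbb{Z}$) complex sequences and $m,n\ge 0$ integers, such that for all $-n\le j\le m$ the quantities $(c_j-a_j)(1-\frac{a_jc_j}{\delta})$, $(d_j-a_j)(1-\frac{a_jd_j}{\delta})$, $(c_j-b_j)(1-\frac{b_jc_j}{\delta})$, $(d_j-b_j)(1-\frac{b_jd_j}{\delta})$ are nonzero. Then $$\sum_{k=-n}^{m}(b_k-a_k)\Big(1-\frac{a_kb_k}{\delta}\Big)(d_k-c_k)\Big(1-\frac{c_kd_k}{\delta}\Big)\frac{\prod_{j=1}^{k-1}(c_j-a_j)(1-\frac{a_jc_j}{\delta})}{\prod_{j=1}^{k}(d_j-a_j)(1-\frac{a_jd_j}{\delta})}\frac{\prod_{j=1}^{k-1}(d_j-b_j)(1-\frac{b_jd_j}{\delta})}{\prod_{j=1}^{k}(c_j-b_j)(1-\frac{b_jc_j}{\delta})}$$ $$=\frac{\prod_{j=1}^{m}(c_j-a_j)(1-\frac{a_jc_j}{\delta})}{\prod_{j=1}^{m}(d_j-a_j)(1-\frac{a_jd_j}{\delta})}\frac{\prod_{j=1}^{m}(d_j-b_j)(1-\frac{b_jd_j}{\delta})}{\prod_{j=1}^{m}(c_j-b_j)(1-\frac{b_jc_j}{\delta})}-\frac{\prod_{j=-n}^{0}(d_j-a_j)(1-\frac{a_jd_j}{\delta})}{\prod_{j=-n}^{0}(c_j-a_j)(1-\frac{a_jc_j}{\delta})}\frac{\prod_{j=-n}^{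0}(c_j-b_j)(1-\frac{b_jc_j}{\delta})}{\prod_{j=-n}^{0}(d_j-b_j)(1-\frac{b_jd_j}{\delta})}.$$
   Context: Products over integer ranges use the convention: for integers $k,m$, $$\prod_{j=k}^{m}A_j=\begin{cases}A_kA_{k+1}\cdots A_m,& m\ge k,\\ 1,& m=k-1,\\ (A_{m+1}A_{m+2}\cdots A_{k-1})^{ -1},& m\le k-2.\end{cases}$$ (The paper denotes the constant $\delta$ by $d$.) -}

module Defs where

open import Level using (Level; _⊔_) renaming (suc to lsuc)
open import Algebra.Bundles using (CommutativeRing)
open import Data.Nat using (ℕ; zero; suc)
open import Data.Integer using (ℤ; +_; ∣_∣; _≤?_) renaming (_+_ to _+ℤ_; _-_ to _-ℤ_; -_ to -ℤ_)
open import Relation.Nullary using (¬_; yes; no)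

-- A field: a commutative ring with 1 ≠ 0 and a (total) inverse operation
-- that is a genuine multiplicative inverse on every nonzero element.
-- (The value of 0⁻¹ is irrelevant and unconstrained.)
record Field (c ℓ : Level) : Set (lsuc (c ⊔ ℓ)) where
  field
    commutativeRing : CommutativeRing c ℓ
  open CommutativeRing commutativeRing public
  field
    _⁻¹        : Carrier → Carrier
    ⁻¹-inverse : ∀ x → ¬ (x ≈ 0#) → (x * (x ⁻¹)) ≈ 1#
    1≉0        : ¬ (1# ≈ 0#)

module FieldOps {c ℓ : Level} (F : Field c ℓ) where
  open Field F

  _÷_ : Carrier → Carrier → Carrier
  x ÷ y = x * (y ⁻¹)

  prodFrom : (ℤ → Carrier) → ℤ → ℕ → Carrier
  prodFrom A s zero    = 1#
  prodFrom A s (suc l) = A s * prodFrom A (s +ℤ + 1) l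

  -- ∏_{j=k}^{m} A j with the paper's convention:
  --   m ≥ k     : A k ⋯ A m
  --   m = k-1   : 1
  --   m ≤ k-2   : (A (m+1) ⋯ A (k-1))⁻¹
  prodZ : (ℤ → Carrier) → ℤ → ℤ → Carrier
  prodZ A k m with k ≤? (m +ℤ + 1)
  ... | yes _ = prodFrom A k ∣ (m +ℤ + 1) -ℤ k ∣
  ... | no  _ = (prodFrom A (m +ℤ + 1) ∣ (k -ℤ + 1) -ℤ m ∣) ⁻¹

  sumFrom : (ℤ → Carrier) → ℤ → ℕ → Carrier
  sumFrom f s zero    = 0#
  sumFrom f s (suc l) = f s + sumFrom f (s +ℤ + 1) l

  sumRange : (ℤ → Carrier) → ℕ → ℕ → Carrier
  sumRange f n m = sumFrom f (-ℤ (+ n)) (suc (m Data.Nat.+ n))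

  φ : Carrier → Carrier → Carrier → Carrier
  φ δ x y = (y - x) * (1# - ((x * y) ÷ δ))

-- The function φ δ x y = (y - x)(1 - x y / δ) satisfies the three-term Plücker relation
-- φ(a,b) φ(c,d) = φ(a,c) φ(b,d) - φ(a,d) φ(b,c).  With A = φ(a,c), B = φ(a,d), C = φ(b,d),
-- D = φ(b,c) and R k = (∏₁ᵏ A / ∏₁ᵏ B) (∏₁ᵏ C / ∏₁ᵏ D), the relation says exactly that the
-- k-th summand is R k - R (k - 1), so the sum telescopes to R m - R (-n-1).  The product
-- convention gives ∏₁^(-n-1) = (∏₋ₙ⁰)⁻¹, which turns R (-n-1) into the subtracted term.

module Submission where

open import Defs
open import Level using (Level)
open import Algebra.Bundles using (Ring)
open import Data.Maybe using (nothing)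
open import Data.Nat using (ℕ; zero; suc; z≤n; s≤s)
import Data.Nat as ℕ
import Data.Nat.Properties as ℕ
open import Data.Integer using (ℤ; +_; -[1+_]; _≤_; +≤+; -≤-; -≤+) renaming (-_ to -ℤ_; _+_ to _+ℤ_; _-_ to _-ℤ_)
import Data.Integer.Properties as ℤ
open import Data.Integer.Tactic.RingSolver using (solve-∀)
open import Data.Product using (_×_; proj₁; proj₂)
open import Function using (_∘_)
open import Relation.Binary.PropositionalEquality as ≡ using (_≡_)
open import Relation.Nullary using (¬_)

module RingDifferences {c ℓ : Level} (R : Ring c ℓ) where
  open Ring R
  open import Relation.Binary.Reasoning.Setoid setoid
  open import Algebra.Properties.Ring R using (x[y-z]≈xy-xz; [y-z]x≈yx-zx)
  open import Algebra.Properties.AbelianGroup +-abelianGroup using (⁻¹-∙-comm)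
  open import Algebra.Properties.Group +-group
    using (x∙y⁻¹≈ε⇒x≈y) renaming (⁻¹-involutive to -‿involutive)
  open import Algebra.Properties.CommutativeSemigroup +-commutativeSemigroup
    using () renaming (interchange to +-interchange)

  difference-of-differences : ∀ a b c d → (a - b) - (c - d) ≈ (a + d) - (b + c)
  difference-of-differences a b c d = begin
    (a - b) + - (c - d)       ≈⟨ +-congˡ (sym (⁻¹-∙-comm c (- d))) ⟩
    (a - b) + (- c + - - d)   ≈⟨ +-congˡ (trans (+-comm (- c) (- - d)) (+-congʳ (-‿involutive d))) ⟩
    (a - b) + (d - c)         ≈⟨ +-interchange a (- b) d (- c) ⟩
    (a + d) + (- b + - c)     ≈⟨ +-congˡ (⁻¹-∙-comm b c) ⟩
    (a + d) - (b + c)         ∎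

  difference-product : ∀ p q r s → (p - q) * (r - s) ≈ (p * r + q * s) - (p * s + q * r)
  difference-product p q r s = begin
    (p - q) * (r - s)                 ≈⟨ [y-z]x≈yx-zx (r - s) p q ⟩
    p * (r - s) - q * (r - s)         ≈⟨ +-cong (x[y-z]≈xy-xz p r s) (-‿cong (x[y-z]≈xy-xz q r s)) ⟩
    (p * r - p * s) - (q * r - q * s) ≈⟨ difference-of-differences _ _ _ _ ⟩
    (p * r + q * s) - (p * s + q * r) ∎

  difference-balance : ∀ {a b c d} → a + d ≈ c + b → a - b ≈ c - d
  difference-balance {a} {b} {c} {d} a+d≈c+b = x∙y⁻¹≈ε⇒x≈y _ _ (begin
    (a - b) - (c - d)     ≈⟨ difference-of-differences a b c d ⟩
    (a + d) - (b + c)     ≈⟨ +-congʳ (trans a+d≈c+b (+-comm c b)) ⟩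
    (b + c) - (b + c)     ≈⟨ -‿inverseʳ _ ⟩
    0#                    ∎)

  difference-telescope : ∀ x y z → (y - z) + (x - y) ≈ x - z
  difference-telescope x y z = begin
    (y - z) + (x - y)       ≈⟨ +-comm _ _ ⟩
    (x - y) + (y - z)       ≈⟨ +-assoc x (- y) (y - z) ⟩
    x + (- y + (y - z))     ≈⟨ +-congˡ (sym (+-assoc (- y) y (- z))) ⟩
    x + ((- y + y) - z)     ≈⟨ +-congˡ (+-congʳ (-‿inverseˡ y)) ⟩
    x + (0# - z)            ≈⟨ +-congˡ (+-identityˡ (- z)) ⟩
    x - z                   ∎

module FieldProperties {f ℓ : Level} (F : Field f ℓ) where
  open Field F
  open FieldOps F
  open import Relation.Binary.Reasoning.Setoid setoid
  open import Algebra.Properties.Ring ring using ([y-z]x≈yx-zx)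
  open import Algebra.Properties.CommutativeSemigroup *-commutativeSemigroup
    using () renaming (interchange to *-interchange)
  open import Algebra.Solver.Ring.NaturalCoefficients commutativeSemiring (λ _ _ → nothing)
    using (solve; _:=_; _:*_)

  private variable
    x y z w : Carrier

  nonzero-resp : x ≈ y → x ≉ 0# → y ≉ 0#
  nonzero-resp x≈y x≉0 = x≉0 ∘ trans x≈y

  ⁻¹-inverseˡ : x ≉ 0# → x ⁻¹ * x ≈ 1#
  ⁻¹-inverseˡ {x} x≉0 = trans (*-comm _ _) (⁻¹-inverse x x≉0)

  ⁻¹-unique : x ≉ 0# → x * y ≈ 1# → y ≈ x ⁻¹
  ⁻¹-unique {x} {y} x≉0 xy≈1 = begin
    y                ≈⟨ *-identityˡ y ⟨
    1# * y           ≈⟨ *-congʳ (⁻¹-inverseˡ x≉0) ⟨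
    (x ⁻¹ * x) * y   ≈⟨ *-assoc _ _ _ ⟩
    x ⁻¹ * (x * y)   ≈⟨ *-congˡ xy≈1 ⟩
    x ⁻¹ * 1#        ≈⟨ *-identityʳ _ ⟩
    x ⁻¹             ∎

  ⁻¹-nonzero : x ≉ 0# → x ⁻¹ ≉ 0#
  ⁻¹-nonzero {x} x≉0 x⁻¹≈0 = 1≉0 (begin
    1#         ≈⟨ ⁻¹-inverse x x≉0 ⟨
    x * x ⁻¹   ≈⟨ *-congˡ x⁻¹≈0 ⟩
    x * 0#     ≈⟨ zeroʳ x ⟩
    0#         ∎)

  *-nonzero : x ≉ 0# → y ≉ 0# → x * y ≉ 0#
  *-nonzero {x} {y} x≉0 y≉0 xy≈0 = y≉0 (begin
    y                ≈⟨ *-identityˡ y ⟨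
    1# * y           ≈⟨ *-congʳ (⁻¹-inverseˡ x≉0) ⟨
    (x ⁻¹ * x) * y   ≈⟨ *-assoc _ _ _ ⟩
    x ⁻¹ * (x * y)   ≈⟨ *-congˡ xy≈0 ⟩
    x ⁻¹ * 0#        ≈⟨ zeroʳ _ ⟩
    0#               ∎)

  ⁻¹-cong : y ≉ 0# → x ≈ y → x ⁻¹ ≈ y ⁻¹
  ⁻¹-cong {y} {x} y≉0 x≈y =
    sym (⁻¹-unique (nonzero-resp (sym x≈y) y≉0) (trans (*-congʳ x≈y) (⁻¹-inverse y y≉0)))

  ⁻¹-involutive : x ≉ 0# → x ⁻¹ ⁻¹ ≈ x
  ⁻¹-involutive x≉0 = sym (⁻¹-unique (⁻¹-nonzero x≉0) (⁻¹-inverseˡ x≉0))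

  ⁻¹-distrib-* : x ≉ 0# → y ≉ 0# → (x * y) ⁻¹ ≈ x ⁻¹ * y ⁻¹
  ⁻¹-distrib-* {x} {y} x≉0 y≉0 = sym (⁻¹-unique (*-nonzero x≉0 y≉0) (begin
    (x * y) * (x ⁻¹ * y ⁻¹)    ≈⟨ *-interchange _ _ _ _ ⟩
    (x * x ⁻¹) * (y * y ⁻¹)    ≈⟨ *-cong (⁻¹-inverse x x≉0) (⁻¹-inverse y y≉0) ⟩
    1# * 1#                    ≈⟨ *-identityˡ 1# ⟩
    1#                         ∎))

  ⁻¹-peel : x ≉ 0# → y ≉ 0# → x ⁻¹ ≈ (y * x) ⁻¹ * y
  ⁻¹-peel {x} {y} x≉0 y≉0 = sym (begin
    (y * x) ⁻¹ * y         ≈⟨ *-congʳ (⁻¹-distrib-* y≉0 x≉0) ⟩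
    (y ⁻¹ * x ⁻¹) * y      ≈⟨ *-congʳ (*-comm _ _) ⟩
    (x ⁻¹ * y ⁻¹) * y      ≈⟨ *-assoc _ _ _ ⟩
    x ⁻¹ * (y ⁻¹ * y)      ≈⟨ *-congˡ (⁻¹-inverseˡ y≉0) ⟩
    x ⁻¹ * 1#              ≈⟨ *-identityʳ _ ⟩
    x ⁻¹                   ∎)

  ÷-cong : w ≉ 0# → x ≈ z → y ≈ w → x ÷ y ≈ z ÷ w
  ÷-cong w≉0 x≈z y≈w = *-cong x≈z (⁻¹-cong w≉0 y≈w)

  ⁻¹-÷-⁻¹ : y ≉ 0# → (x ⁻¹) ÷ (y ⁻¹) ≈ y ÷ x
  ⁻¹-÷-⁻¹ y≉0 = trans (*-congˡ (⁻¹-involutive y≉0)) (*-comm _ _)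

  ratio-step : ∀ {a b c d x y z w} → b ≉ 0# → y ≉ 0# → d ≉ 0# → w ≉ 0# →
    ((x * z - y * w) * (a ÷ (b * y))) * (c ÷ (d * w))
      ≈ ((a * x) ÷ (b * y)) * ((c * z) ÷ (d * w)) - (a ÷ b) * (c ÷ d)
  ratio-step {a} {b} {c} {d} {x} {y} {z} {w} b≉0 y≉0 d≉0 w≉0 = begin
    ((x * z - y * w) * (a * (b * y) ⁻¹)) * (c * (d * w) ⁻¹)
      ≈⟨ *-cong (*-congˡ (*-congˡ by⁻¹)) (*-congˡ dw⁻¹) ⟩
    ((x * z - y * w) * (a * (b ⁻¹ * y ⁻¹))) * (c * (d ⁻¹ * w ⁻¹))
      ≈⟨ trans (*-congʳ ([y-z]x≈yx-zx _ _ _)) ([y-z]x≈yx-zx _ _ _) ⟩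
    ((x * z) * (a * (b ⁻¹ * y ⁻¹))) * (c * (d ⁻¹ * w ⁻¹))
      - ((y * w) * (a * (b ⁻¹ * y ⁻¹))) * (c * (d ⁻¹ * w ⁻¹))
      ≈⟨ +-cong (regroup₁ x z a (b ⁻¹) (y ⁻¹) c (d ⁻¹) (w ⁻¹))
                (-‿cong (regroup₂ y w a (b ⁻¹) (y ⁻¹) c (d ⁻¹) (w ⁻¹))) ⟩
    ((a * x) * (b ⁻¹ * y ⁻¹)) * ((c * z) * (d ⁻¹ * w ⁻¹))
      - ((a * b ⁻¹) * (c * d ⁻¹)) * ((y * y ⁻¹) * (w * w ⁻¹))
      ≈⟨ +-cong (sym (*-cong (*-congˡ by⁻¹) (*-congˡ dw⁻¹)))
                (-‿cong (trans (*-congˡ (*-cong (⁻¹-inverse y y≉0) (⁻¹-inverse w w≉0)))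
                               (trans (*-congˡ (*-identityˡ 1#)) (*-identityʳ _)))) ⟩
    ((a * x) * (b * y) ⁻¹) * ((c * z) * (d * w) ⁻¹) - (a * b ⁻¹) * (c * d ⁻¹)
      ∎
    where
    by⁻¹ : (b * y) ⁻¹ ≈ b ⁻¹ * y ⁻¹
    by⁻¹ = ⁻¹-distrib-* b≉0 y≉0
    dw⁻¹ : (d * w) ⁻¹ ≈ d ⁻¹ * w ⁻¹
    dw⁻¹ = ⁻¹-distrib-* d≉0 w≉0
    regroup₁ : ∀ x z a b' y' c d' w' →
      ((x * z) * (a * (b' * y'))) * (c * (d' * w'))
        ≈ ((a * x) * (b' * y')) * ((c * z) * (d' * w'))
    regroup₁ = solve 8 (λ x z a b' y' c d' w' →
      ((x :* z) :* (a :* (b' :* y'))) :* (c :* (d' :* w'))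
        := ((a :* x) :* (b' :* y')) :* ((c :* z) :* (d' :* w'))) refl
    regroup₂ : ∀ y w a b' y' c d' w' →
      ((y * w) * (a * (b' * y'))) * (c * (d' * w'))
        ≈ ((a * b') * (c * d')) * ((y * y') * (w * w'))
    regroup₂ = solve 8 (λ y w a b' y' c d' w' →
      ((y :* w) :* (a :* (b' :* y'))) :* (c :* (d' :* w'))
        := ((a :* b') :* (c :* d')) :* ((y :* y') :* (w :* w'))) refl

module PlückerRelation {f ℓ : Level} (F : Field f ℓ) where
  open Field F
  open FieldOps F
  open RingDifferences ring
  open import Relation.Binary.Reasoning.Setoid setoid
  open import Algebra.Solver.Ring.NaturalCoefficients commutativeSemiring (λ _ _ → nothing)
    using (solve; _:=_; _:+_; _:*_; con)

  -- φ δ x y = φ⁺ u x y - φ⁻ u x y with u = δ ⁻¹; splitting off the subtraction is what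
  -- lets the natural-coefficient ring solver prove plücker-balance.
  private
    φ⁺ φ⁻ : Carrier → Carrier → Carrier → Carrier
    φ⁺ u x y = y * 1# + x * (x * y * u)
    φ⁻ u x y = y * (x * y * u) + x * 1#

    φφ⁺ φφ⁻ : Carrier → Carrier → Carrier → Carrier → Carrier → Carrier
    φφ⁺ u a b c d = φ⁺ u a b * φ⁺ u c d + φ⁻ u a b * φ⁻ u c d
    φφ⁻ u a b c d = φ⁺ u a b * φ⁻ u c d + φ⁻ u a b * φ⁺ u c d

    φ-split : ∀ δ x y → φ δ x y ≈ φ⁺ (δ ⁻¹) x y - φ⁻ (δ ⁻¹) x y
    φ-split δ x y = difference-product y x 1# (x * y * δ ⁻¹)

    φ*φ-split : ∀ δ a b c d → φ δ a b * φ δ c d ≈ φφ⁺ (δ ⁻¹) a b c d - φφ⁻ (δ ⁻¹) a b c d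
    φ*φ-split δ a b c d = trans (*-cong (φ-split δ a b) (φ-split δ c d)) (difference-product _ _ _ _)

    plücker-balance : ∀ u a b c d →
      φφ⁺ u a b c d + (φφ⁻ u a c b d + φφ⁺ u a d b c)
        ≈ (φφ⁺ u a c b d + φφ⁻ u a d b c) + φφ⁻ u a b c d
    plücker-balance = solve 5 (λ u a b c d →
      let P = λ x y → y :* con 1 :+ x :* (x :* y :* u)
          Q = λ x y → y :* (x :* y :* u) :+ x :* con 1
          PP = λ a b c d → P a b :* P c d :+ Q a b :* Q c d
          PQ = λ a b c d → P a b :* Q c d :+ Q a b :* P c d
      in PP a b c d :+ (PQ a c b d :+ PP a d b c) := (PP a c b d :+ PQ a d b c) :+ PQ a b c d) refl

  φ-plücker : ∀ δ a b c d → φ δ a b * φ δ c d ≈ φ δ a c * φ δ b d - φ δ a d * φ δ b c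
  φ-plücker δ a b c d = begin
    φ δ a b * φ δ c d
      ≈⟨ φ*φ-split δ a b c d ⟩
    φφ⁺ u a b c d - φφ⁻ u a b c d
      ≈⟨ difference-balance (plücker-balance u a b c d) ⟩
    (φφ⁺ u a c b d + φφ⁻ u a d b c) - (φφ⁻ u a c b d + φφ⁺ u a d b c)
      ≈⟨ difference-of-differences _ _ _ _ ⟨
    (φφ⁺ u a c b d - φφ⁻ u a c b d) - (φφ⁺ u a d b c - φφ⁻ u a d b c)
      ≈⟨ +-cong (φ*φ-split δ a c b d) (-‿cong (φ*φ-split δ a d b c)) ⟨
    φ δ a c * φ δ b d - φ δ a d * φ δ b c
      ∎
    where u = δ ⁻¹

neg≤-[1+]⇒< : ∀ {i n} → -ℤ (+ n) ≤ -[1+ i ] → i ℕ.< n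
neg≤-[1+]⇒< {n = zero}  ()
neg≤-[1+]⇒< {n = suc n} (-≤- i≤n) = s≤s i≤n

<⇒neg≤-[1+] : ∀ {i n} → i ℕ.< n → -ℤ (+ n) ≤ -[1+ i ]
<⇒neg≤-[1+] (s≤s i≤n) = -≤- i≤n

module IntegerRanges {f ℓ : Level} (F : Field f ℓ) where
  open Field F
  open FieldOps F
  open FieldProperties F
  open RingDifferences ring using (difference-telescope)
  open import Relation.Binary.Reasoning.Setoid setoid

  NonZeroOn : (ℤ → Carrier) → ℤ → ℤ → Set ℓ
  NonZeroOn X lo hi = ∀ j → lo ≤ j → j ≤ hi → X j ≉ 0#

  prodFrom-snoc : ∀ X s l → prodFrom X s (suc l) ≈ prodFrom X s l * X (s +ℤ + l)
  prodFrom-snoc X s zero =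
    trans (*-comm _ _) (*-congˡ (reflexive (≡.cong X (≡.sym (ℤ.+-identityʳ s)))))
  prodFrom-snoc X s (suc l) = begin
    X s * prodFrom X (s +ℤ + 1) (suc l)
      ≈⟨ *-congˡ (prodFrom-snoc X (s +ℤ + 1) l) ⟩
    X s * (prodFrom X (s +ℤ + 1) l * X (s +ℤ + 1 +ℤ + l))
      ≈⟨ *-assoc _ _ _ ⟨
    (X s * prodFrom X (s +ℤ + 1) l) * X (s +ℤ + 1 +ℤ + l)
      ≡⟨ ≡.cong (λ j → X s * prodFrom X (s +ℤ + 1) l * X j) (ℤ.+-assoc s (+ 1) (+ l)) ⟩
    (X s * prodFrom X (s +ℤ + 1) l) * X (s +ℤ + suc l)
      ∎

  prodZ-one≡prodFrom : ∀ X i → prodZ X (+ 1) (+ i) ≡ prodFrom X (+ 1) i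
  prodZ-one≡prodFrom X zero    = ≡.refl
  prodZ-one≡prodFrom X (suc i) = ≡.cong (prodFrom X (+ 1)) (ℕ.+-comm i 1)

  prodZ-one-positive : ∀ X i → prodZ X (+ 1) (+ suc i) ≈ prodZ X (+ 1) (+ i) * X (+ suc i)
  prodZ-one-positive X i = begin
    prodZ X (+ 1) (+ suc i)              ≡⟨ prodZ-one≡prodFrom X (suc i) ⟩
    prodFrom X (+ 1) (suc i)             ≈⟨ prodFrom-snoc X (+ 1) i ⟩
    prodFrom X (+ 1) i * X (+ suc i)     ≡⟨ ≡.cong (_* X (+ suc i)) (prodZ-one≡prodFrom X i) ⟨
    prodZ X (+ 1) (+ i) * X (+ suc i)    ∎

  prodZ-to-zero-suc : ∀ X i → prodZ X (-ℤ (+ suc i)) (+ 0) ≡ X -[1+ i ] * prodZ X (-ℤ (+ i)) (+ 0)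
  prodZ-to-zero-suc X zero    = ≡.refl
  prodZ-to-zero-suc X (suc i) = ≡.refl

  prodZ-one-negative : ∀ X i → prodZ X (+ 1) -[1+ i ] ≡ prodZ X (-ℤ (+ i)) (+ 0) ⁻¹
  prodZ-one-negative X zero    = ≡.refl
  prodZ-one-negative X (suc i) = ≡.refl

  prodZ-one-pred-negative : ∀ X i → prodZ X (+ 1) (-[1+ i ] -ℤ + 1) ≡ prodZ X (-ℤ (+ suc i)) (+ 0) ⁻¹
  prodZ-one-pred-negative X i =
    ≡.trans (≡.cong (prodZ X (+ 1)) (ℤ.neg-minus-pos i 1)) (prodZ-one-negative X (suc i))

  module _ {X : ℤ → Carrier} {n m : ℕ} (X≉0 : NonZeroOn X (-ℤ (+ n)) (+ m)) where

    prodZ-one-nonzero : ∀ i → i ℕ.≤ m → prodZ X (+ 1) (+ i) ≉ 0#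
    prodZ-one-nonzero zero    _    = 1≉0
    prodZ-one-nonzero (suc i) i<m  = nonzero-resp (sym (prodZ-one-positive X i))
      (*-nonzero (prodZ-one-nonzero i (ℕ.<⇒≤ i<m)) (X≉0 (+ suc i) ℤ.neg-≤-pos (+≤+ i<m)))

    prodZ-to-zero-nonzero : ∀ i → i ℕ.≤ n → prodZ X (-ℤ (+ i)) (+ 0) ≉ 0#
    prodZ-to-zero-nonzero zero    _   = *-nonzero (X≉0 (+ 0) ℤ.neg-≤-pos (+≤+ z≤n)) 1≉0
    prodZ-to-zero-nonzero (suc i) i<n rewrite prodZ-to-zero-suc X i =
      *-nonzero (X≉0 -[1+ i ] (<⇒neg≤-[1+] i<n) -≤+) (prodZ-to-zero-nonzero i (ℕ.<⇒≤ i<n))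

    prodZ-one-pred-nonzero : ∀ k → -ℤ (+ n) ≤ k → k ≤ + m → prodZ X (+ 1) (k -ℤ + 1) ≉ 0#
    prodZ-one-pred-nonzero (+ zero)  _   _         = ⁻¹-nonzero (prodZ-to-zero-nonzero 0 z≤n)
    prodZ-one-pred-nonzero (+ suc i) _   (+≤+ i<m) = prodZ-one-nonzero i (ℕ.<⇒≤ i<m)
    prodZ-one-pred-nonzero -[1+ i ]  n≤k _ =
      ≡.subst (_≉ 0#) (≡.sym (prodZ-one-pred-negative X i))
        (⁻¹-nonzero (prodZ-to-zero-nonzero (suc i) (neg≤-[1+]⇒< n≤k)))

    prodZ-one-step : ∀ k → -ℤ (+ n) ≤ k → prodZ X (+ 1) k ≈ prodZ X (+ 1) (k -ℤ + 1) * X k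
    prodZ-one-step (+ zero)  _ =
      sym (trans (*-congˡ (sym (*-identityʳ _))) (⁻¹-inverseˡ (prodZ-to-zero-nonzero 0 z≤n)))
    prodZ-one-step (+ suc i) _ = prodZ-one-positive X i
    prodZ-one-step -[1+ i ]  n≤k = begin
      prodZ X (+ 1) -[1+ i ]                          ≡⟨ prodZ-one-negative X i ⟩
      P i ⁻¹                                          ≈⟨ ⁻¹-peel (prodZ-to-zero-nonzero i i≤n) (X≉0 -[1+ i ] n≤k -≤+) ⟩
      (X -[1+ i ] * P i) ⁻¹ * X -[1+ i ]              ≡⟨ ≡.cong (λ y → y ⁻¹ * X -[1+ i ]) (prodZ-to-zero-suc X i) ⟨
      P (suc i) ⁻¹ * X -[1+ i ]                       ≡⟨ ≡.cong (_* X -[1+ i ]) (prodZ-one-pred-negative X i) ⟨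
      prodZ X (+ 1) (-[1+ i ] -ℤ + 1) * X -[1+ i ]    ∎
      where
      P : ℕ → Carrier
      P j = prodZ X (-ℤ (+ j)) (+ 0)
      i≤n : i ℕ.≤ n
      i≤n = ℕ.<⇒≤ (neg≤-[1+]⇒< n≤k)

  module _ (g R : ℤ → Carrier) where
    private
      DifferenceAt : ℤ → Set ℓ
      DifferenceAt k = g k ≈ R k - R (k -ℤ + 1)

    sumFrom-telescope : ∀ s l → (∀ t → t ℕ.< l → DifferenceAt (s +ℤ + t)) →
      sumFrom g s l ≈ R (s +ℤ + l -ℤ + 1) - R (s -ℤ + 1)
    sumFrom-telescope s zero _ rewrite ℤ.+-identityʳ s = sym (-‿inverseʳ _)
    sumFrom-telescope s (suc l) diff = begin
      g s + sumFrom g (s +ℤ + 1) l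
        ≈⟨ +-cong diff-s (sumFrom-telescope (s +ℤ + 1) l diff-tail) ⟩
      (R s - R (s -ℤ + 1)) + (R (s +ℤ + 1 +ℤ + l -ℤ + 1) - R (s +ℤ + 1 -ℤ + 1))
        ≡⟨ ≡.cong₂ (λ i j → (R s - R (s -ℤ + 1)) + (R (i -ℤ + 1) - R j))
                   (ℤ.+-assoc s (+ 1) (+ l)) (≡.trans (ℤ.+-assoc s (+ 1) -[1+ 0 ]) (ℤ.+-identityʳ s)) ⟩
      (R s - R (s -ℤ + 1)) + (R (s +ℤ + suc l -ℤ + 1) - R s)
        ≈⟨ difference-telescope _ _ _ ⟩
      R (s +ℤ + suc l -ℤ + 1) - R (s -ℤ + 1)
        ∎
      where
      diff-s : DifferenceAt s
      diff-s = ≡.subst DifferenceAt (ℤ.+-identityʳ s) (diff 0 (s≤s z≤n))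
      diff-tail : ∀ t → t ℕ.< l → DifferenceAt (s +ℤ + 1 +ℤ + t)
      diff-tail t t<l = ≡.subst DifferenceAt (≡.sym (ℤ.+-assoc s (+ 1) (+ t))) (diff (suc t) (s≤s t<l))

    sumRange-telescope : ∀ n m → (∀ k → -ℤ (+ n) ≤ k → k ≤ + m → DifferenceAt k) →
      sumRange g n m ≈ R (+ m) - R -[1+ n ]
    sumRange-telescope n m diff = begin
      sumFrom g (-ℤ (+ n)) (suc (m ℕ.+ n))
        ≈⟨ sumFrom-telescope _ _ (λ t t<l → diff _ (ℤ.i≤i+j _ (+ t)) (in-range t t<l)) ⟩
      R (-ℤ (+ n) +ℤ + suc (m ℕ.+ n) -ℤ + 1) - R (-ℤ (+ n) -ℤ + 1)
        ≡⟨ ≡.cong₂ (λ i j → R i - R j) (last (+ m) (+ n)) (first n) ⟩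
      R (+ m) - R -[1+ n ]
        ∎
      where
      last : ∀ M N → -ℤ N +ℤ (+ 1 +ℤ (M +ℤ N)) -ℤ + 1 ≡ M
      last = solve-∀
      first : ∀ n → -ℤ (+ n) -ℤ + 1 ≡ -[1+ n ]
      first zero    = ≡.refl
      first (suc n) = ℤ.neg-minus-pos n 1
      -n+[m+n]≡m : ∀ M N → -ℤ N +ℤ (M +ℤ N) ≡ M
      -n+[m+n]≡m = solve-∀
      in-range : ∀ t → t ℕ.< suc (m ℕ.+ n) → -ℤ (+ n) +ℤ + t ≤ + m
      in-range t (s≤s t≤m+n) = ℤ.≤-trans (ℤ.+-monoʳ-≤ (-ℤ (+ n)) (+≤+ t≤m+n))
                                         (ℤ.≤-reflexive (-n+[m+n]≡m (+ m) (+ n)))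

  telescoping-ratio-sum : ∀ (p A B C D : ℤ → Carrier) (n m : ℕ) →
    NonZeroOn A (-ℤ (+ n)) (+ m) → NonZeroOn B (-ℤ (+ n)) (+ m) →
    NonZeroOn C (-ℤ (+ n)) (+ m) → NonZeroOn D (-ℤ (+ n)) (+ m) →
    (∀ k → p k ≈ A k * C k - B k * D k) →
    sumRange (λ k → (p k * (prodZ A (+ 1) (k -ℤ + 1) ÷ prodZ B (+ 1) k))
                      * (prodZ C (+ 1) (k -ℤ + 1) ÷ prodZ D (+ 1) k)) n m
      ≈ (prodZ A (+ 1) (+ m) ÷ prodZ B (+ 1) (+ m)) * (prodZ C (+ 1) (+ m) ÷ prodZ D (+ 1) (+ m))
        - (prodZ B (-ℤ (+ n)) (+ 0) ÷ prodZ A (-ℤ (+ n)) (+ 0))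
          * (prodZ D (-ℤ (+ n)) (+ 0) ÷ prodZ C (-ℤ (+ n)) (+ 0))
  telescoping-ratio-sum p A B C D n m A≉0 B≉0 C≉0 D≉0 p≈AC-BD = begin
    sumRange summand n m            ≈⟨ sumRange-telescope summand ratio n m summand≈Δratio ⟩
    ratio (+ m) - ratio -[1+ n ]    ≈⟨ +-congˡ (-‿cong ratio-below) ⟩
    ratio (+ m) - (Q B ÷ Q A) * (Q D ÷ Q C) ∎
    where
    Q : (ℤ → Carrier) → Carrier
    Q X = prodZ X (-ℤ (+ n)) (+ 0)
    ratio summand : ℤ → Carrier
    ratio k = (prodZ A (+ 1) k ÷ prodZ B (+ 1) k) * (prodZ C (+ 1) k ÷ prodZ D (+ 1) k)
    summand k = (p k * (prodZ A (+ 1) (k -ℤ + 1) ÷ prodZ B (+ 1) k))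
                  * (prodZ C (+ 1) (k -ℤ + 1) ÷ prodZ D (+ 1) k)

    ratio-below : ratio -[1+ n ] ≈ (Q B ÷ Q A) * (Q D ÷ Q C)
    ratio-below rewrite prodZ-one-negative A n | prodZ-one-negative B n
                      | prodZ-one-negative C n | prodZ-one-negative D n =
      *-cong (⁻¹-÷-⁻¹ (prodZ-to-zero-nonzero B≉0 n ℕ.≤-refl))
             (⁻¹-÷-⁻¹ (prodZ-to-zero-nonzero D≉0 n ℕ.≤-refl))

    summand≈Δratio : ∀ k → -ℤ (+ n) ≤ k → k ≤ + m → summand k ≈ ratio k - ratio (k -ℤ + 1)
    summand≈Δratio k n≤k k≤m = begin
      (p k * (a ÷ prodZ B (+ 1) k)) * (c ÷ prodZ D (+ 1) k)
        ≈⟨ *-cong (*-cong (p≈AC-BD k) (÷-cong bB≉0 refl (step B≉0))) (÷-cong dD≉0 refl (step D≉0)) ⟩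
      ((A k * C k - B k * D k) * (a ÷ (b * B k))) * (c ÷ (d * D k))
        ≈⟨ ratio-step b≉0 (B≉0 k n≤k k≤m) d≉0 (D≉0 k n≤k k≤m) ⟩
      ((a * A k) ÷ (b * B k)) * ((c * C k) ÷ (d * D k)) - (a ÷ b) * (c ÷ d)
        ≈⟨ +-congʳ (sym (*-cong (÷-cong bB≉0 (step A≉0) (step B≉0)) (÷-cong dD≉0 (step C≉0) (step D≉0)))) ⟩
      ratio k - ratio (k -ℤ + 1)
        ∎
      where
      a b c d : Carrier
      a = prodZ A (+ 1) (k -ℤ + 1)
      b = prodZ B (+ 1) (k -ℤ + 1)
      c = prodZ C (+ 1) (k -ℤ + 1)
      d = prodZ D (+ 1) (k -ℤ + 1)
      step : ∀ {X} → NonZeroOn X (-ℤ (+ n)) (+ m) → prodZ X (+ 1) k ≈ prodZ X (+ 1) (k -ℤ + 1) * X k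
      step X≉0 = prodZ-one-step X≉0 k n≤k
      b≉0 : b ≉ 0#
      b≉0 = prodZ-one-pred-nonzero B≉0 k n≤k k≤m
      d≉0 : d ≉ 0#
      d≉0 = prodZ-one-pred-nonzero D≉0 k n≤k k≤m
      bB≉0 : b * B k ≉ 0#
      bB≉0 = *-nonzero b≉0 (B≉0 k n≤k k≤m)
      dD≉0 : d * D k ≉ 0#
      dD≉0 = *-nonzero d≉0 (D≉0 k n≤k k≤m)

corollary3p7 : ∀ {c ℓ : Level} (F : Field c ℓ) →
  let open Field F
      open FieldOps F
  in (δ : Carrier) → ¬ (δ ≈ 0#) →
     (a b c d : ℤ → Carrier) (m n : ℕ) →
     (∀ (j : ℤ) → -ℤ (+ n) ≤ j → j ≤ + m →
        (¬ (φ δ (a j) (c j) ≈ 0#)) × (¬ (φ δ (a j) (d j) ≈ 0#))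
        × (¬ (φ δ (b j) (c j) ≈ 0#)) × (¬ (φ δ (b j) (d j) ≈ 0#))) →
     let A = λ j → φ δ (a j) (c j)
         B = λ j → φ δ (a j) (d j)
         C = λ j → φ δ (b j) (d j)
         D = λ j → φ δ (b j) (c j)
     in sumRange (λ k → ((((φ δ (a k) (b k) * φ δ (c k) (d k))
              * (prodZ A (+ 1) (k -ℤ + 1) ÷ prodZ B (+ 1) k))
              * (prodZ C (+ 1) (k -ℤ + 1) ÷ prodZ D (+ 1) k)))) n m
        ≈ ((prodZ A (+ 1) (+ m) ÷ prodZ B (+ 1) (+ m))
             * (prodZ C (+ 1) (+ m) ÷ prodZ D (+ 1) (+ m))
           - (prodZ B (-ℤ (+ n)) (+ 0) ÷ prodZ A (-ℤ (+ n)) (+ 0))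
             * (prodZ D (-ℤ (+ n)) (+ 0) ÷ prodZ C (-ℤ (+ n)) (+ 0)))
-- δ ≉ 0# is deliberately unused: φ-plücker holds for every value of δ ⁻¹, even the
-- unconstrained 0# ⁻¹.
corollary3p7 F δ _ a b c d m n φ≉0 =
  telescoping-ratio-sum (λ k → φ δ (a k) (b k) * φ δ (c k) (d k))
    (λ j → φ δ (a j) (c j)) (λ j → φ δ (a j) (d j))
    (λ j → φ δ (b j) (d j)) (λ j → φ δ (b j) (c j)) n m
    (λ j n≤j j≤m → proj₁ (φ≉0 j n≤j j≤m))
    (λ j n≤j j≤m → proj₁ (proj₂ (φ≉0 j n≤j j≤m)))
    (λ j n≤j j≤m → proj₂ (proj₂ (proj₂ (φ≉0 j n≤j j≤m))))
    (λ j n≤j j≤m → proj₁ (proj₂ (proj₂ (φ≉0 j n≤j j≤m))))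
    (λ k → φ-plücker δ (a k) (b k) (c k) (d k))
  where
  open Field F
  open FieldOps F
  open PlückerRelation F
  open IntegerRanges F
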